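{- Let $\varphi$ be a normal form $\mathrm{GF{+}TG}$ sentence over a signature $\sigma$ (as described in the context). Then $\varphi$ has a finite model if and only if there are a set $\boldsymbol\alpha$ of $1$-types over $\sigma$ and a set $\boldsymbol\beta$ of non-degenerate guarded $2$-types over $\sigma$ such that (i) the sentences $\varphi_B$ and $\varphi_C$ constructed from $\boldsymbol\alpha$ and $\boldsymbol\beta$ both have finite models in which all transitive symbols are interpreted as transitive relations, and (ii) for every $\beta\in\boldsymbol\beta$, every two-element $\sigma$-structure whose two distinct elements realize (in this order) the type $\beta$ satisfies all the $\forall$-conjuncts of $\varphi$.
   Context: GF+TG: relational signature $\sigma$ (no constants) containing distinguished binary transitive symbols $T_1,T_2,\dots$ which may only occur as guards in guarded formulas (equality allowed); models interpret each $T_s$ as a transitive relation. Normal form: $\varphi$ is a conjunction of (a) $\forall\exists^{ntr}$-conjuncts $\forall\bar x(\gamma_h(\bar x)\Rightarrow\exists\bar y(\vartheta_h(\bar x,\bar y)\wedge\psi_h(\bar x,\bar y)))$, (b) $\forall\exists^{tr}$-conjuncts $\forall x(\gamma_i(x)\Rightarrow\exists y(\theta_i(x,y)\wedge\psi_i(x,y)))$, (c) conjuncts $\forall\bar x(\gamma_j(\bar x)\Rightarrow\psi_j(\bar x))$, and (d) for each $P\in\sigma$ the conjunct $\forall\bar x(P(\bar x)\Rightarrow\bigwedge_{1\le i,j\le|\bar x|}\mathsf{Aux}(x_i,x_j))$ with $\mathsf{Aux}\in\sigma$ a binary non-transitive symbol; $\gamma_h,\gamma_i,\vartheta_h$ are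 atoms with non-transitive symbols, $\theta_i$ atoms with transitive symbols, $\gamma_j$ atoms, and $\psi_h,\psi_i,\psi_j$ quantifier-free without transitive symbols. The $\forall$-conjuncts are those of kinds (c) and (d). An $\ell$-type over $\sigma$ is a maximal consistent set of atomic and negated atomic formulas (including equalities) over $\sigma$ in variables $x_1,\dots,x_\ell$, identified with the conjunction of its elements; a $2$-type is non-degenerate if it contains $x_1\neq x_2$, and guarded if it contains a positive atom containing both variables. For a $2$-type $\beta$, its transitive-free reduction $\beta^-$ is obtained by removing the literals $T(x_1,x_2),T(x_2,x_1),\neg T(x_1,x_2),\neg T(x_2,x_1)$ for all transitive $T$. Then $\varphi_B$ is the conjunction of: all $\forall\exists^{ntr}$-conjuncts of $\varphi$; all conjuncts of kinds (c) and (d); $\forall xy(T_s(x,y)\Rightarrow x=y)$ for each transitive $T_s$; $\exists xy\,\beta^-(x,y)$ for each $\beta\in\boldsymbol\beta$; $\exists x\,\alpha(x)$ for each $\alpha\in\boldsymbol\alpha$; and $\forall x\bigvee_{\alpha\in\boldsymbol\alpha}\alpha(x)$. And $\varphi_C$ is the conjunction of: all $\forall\exists^{tr}$-conjuncts of $\varphi$; all conjuncts of kind (c) whose guard $\gamma_j$ uses a transitive symbol; for each $P\in\sigma$ and each tuple $\bar x$ of length equal to the arity of $P$ built from the variables $x,y$ and containing each of them at least once, $\forall xy(P(\bar x)\Rightarrow\mathsf{Aux}(x,y))$; $\forall xy(\mathsf{Aux}(x,y)\Rightarrow(x\neq y\Rightarrow\bigvee_{\beta\in\boldsymbol\beta}\beta^-(x,y)))$;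 $\exists x\,\alpha(x)$ for each $\alpha\in\boldsymbol\alpha$; and $\forall x\bigvee_{\alpha\in\boldsymbol\alpha}\alpha(x)$. -}

module Defs where

open import Data.Nat using (ℕ; zero; suc; _+_)
open import Data.Fin using (Fin; zero; suc; _≟_)
open import Data.Vec using (Vec; []; _∷_; map; lookup)
open import Data.Vec.Membership.Propositional using () renaming (_∈_ to _∈ᵥ_)
import Data.Vec.Functional as VF
open import Data.List using (List)
open import Data.List.Relation.Unary.All using (All)
open import Data.List.Relation.Unary.Any using (Any)
open import Data.Bool using (Bool; true; false)
open import Data.Product using (Σ; ∃; _×_; _,_)
open import Data.Sum using (_⊎_)
open import Data.Empty using (⊥)
open import Data.Unit using (⊤)
open import Relation.Nullary using (¬_)
open import Relation.Nullary.Decidable using (⌊_⌋)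
open import Relation.Binary.PropositionalEquality using (_≡_; _≢_)

record Signature : Set where
  field
    nTr : ℕ
    nN  : ℕ
    arN : Fin nN → ℕ

module _ (σ : Signature) where
  open Signature σ

  data Sym : Set where
    tr  : Fin nTr → Sym
    nt  : Fin nN → Sym
    aux : Sym

  ar : Sym → ℕ
  ar (tr _) = 2
  ar (nt P) = arN P
  ar aux    = 2

  data Atom (k : ℕ) : Set where
    rel : (s : Sym) → Vec (Fin k) (ar s) → Atom k
    eq  : Fin k → Fin k → Atom k

  data QF (k : ℕ) : Set where
    atm : Atom k → QF k
    ⊤q ⊥q : QF k
    ¬q : QF k → QF k
    _∧q_ _∨q_ _⇒q_ : QF k → QF k → QF k

  Mentions : ∀ {k} → Atom k → Fin k → Set
  Mentions (rel s xs) i = i ∈ᵥ xs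
  Mentions (eq a b)   i = i ≡ a ⊎ i ≡ b

  Guards : ∀ {k} → Atom k → Set
  Guards {k} γ = (i : Fin k) → Mentions γ i

  NoTrA : ∀ {k} → Atom k → Set
  NoTrA (rel (tr _) _) = ⊥
  NoTrA _              = ⊤

  UsesTr : ∀ {k} → Atom k → Set
  UsesTr (rel (tr _) _) = ⊤
  UsesTr _              = ⊥

  NoTr : ∀ {k} → QF k → Set
  NoTr (atm A)   = NoTrA A
  NoTr ⊤q        = ⊤
  NoTr ⊥q        = ⊤
  NoTr (¬q ψ)    = NoTr ψ
  NoTr (ψ ∧q χ)  = NoTr ψ × NoTr χ
  NoTr (ψ ∨q χ)  = NoTr ψ × NoTr χ
  NoTr (ψ ⇒q χ)  = NoTr ψ × NoTr χ

  -- (a)  ∀x̄ (γ(x̄) ⇒ ∃ȳ (ϑ(x̄,ȳ) ∧ ψ(x̄,ȳ))),  |x̄| = k, |ȳ| = m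
  record ConjA : Set where
    field
      k m   : ℕ
      γ     : Atom k
      γ-ntr : NoTrA γ
      γ-grd : Guards γ
      ϑ     : Atom (k + m)
      ϑ-ntr : NoTrA ϑ
      ϑ-grd : Guards ϑ
      ψ     : QF (k + m)
      ψ-ntr : NoTr ψ

  -- (b)  ∀x (γ(x) ⇒ ∃y (θ(x,y) ∧ ψ(x,y)))   (x = x_1, y = x_2)
  record ConjB : Set where
    field
      γ     : Atom 1
      γ-ntr : NoTrA γ
      γ-grd : Guards γ
      θ     : Atom 2
      θ-tr  : UsesTr θ
      θ-grd : Guards θ
      ψ     : QF 2
      ψ-ntr : NoTr ψ

  -- (c)  ∀x̄ (γ(x̄) ⇒ ψ(x̄))
  record ConjC : Set where
    field
      k     : ℕ
      γ     : Atom k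
      γ-grd : Guards γ
      ψ     : QF k
      ψ-ntr : NoTr ψ

  -- a normal form sentence: the conjuncts of kinds (a),(b),(c);
  -- the conjuncts of kind (d) are determined by σ (see SatD).
  record NF : Set where
    field
      as : List ConjA
      bs : List ConjB
      cs : List ConjC

  record Str (n : ℕ) : Set where
    field
      R : (s : Sym) → Vec (Fin (suc n)) (ar s) → Bool

  Dom : ℕ → Set
  Dom n = Fin (suc n)

  module _ {n : ℕ} (M : Str n) where
    open Str M

    holdsA : ∀ {k} → Atom k → (Fin k → Dom n) → Set
    holdsA (rel s xs) v = R s (map v xs) ≡ true
    holdsA (eq i j)   v = v i ≡ v j

    holdsQ : ∀ {k} → QF k → (Fin k → Dom n) → Set
    holdsQ (atm A)  v = holdsA A v
    holdsQ ⊤q       v = ⊤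
    holdsQ ⊥q       v = ⊥
    holdsQ (¬q ψ)   v = ¬ holdsQ ψ v
    holdsQ (ψ ∧q χ) v = holdsQ ψ v × holdsQ χ v
    holdsQ (ψ ∨q χ) v = holdsQ ψ v ⊎ holdsQ χ v
    holdsQ (ψ ⇒q χ) v = holdsQ ψ v → holdsQ χ v

    tpOf : ∀ {ℓ} → (Fin ℓ → Dom n) → Atom ℓ → Bool
    tpOf v (rel s xs) = R s (map v xs)
    tpOf v (eq i j)   = ⌊ v i ≟ v j ⌋

    Transitive : Set
    Transitive = ∀ (T : Fin nTr) (a b c : Dom n)
      → R (tr T) (a ∷ b ∷ []) ≡ true → R (tr T) (b ∷ c ∷ []) ≡ true
      → R (tr T) (a ∷ c ∷ []) ≡ true

    SatA : ConjA → Set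
    SatA c = (v : Fin (ConjA.k c) → Dom n) → holdsA (ConjA.γ c) v →
      Σ (Fin (ConjA.m c) → Dom n) λ w →
        holdsA (ConjA.ϑ c) (v VF.++ w) × holdsQ (ConjA.ψ c) (v VF.++ w)

  pair : ∀ {D : Set} → D → D → Fin 2 → D
  pair a b zero       = a
  pair a b (suc zero) = b

  single : ∀ {D : Set} → D → Fin 1 → D
  single a _ = a

  module _ {n : ℕ} (M : Str n) where
    open Str M

    SatB : ConjB → Set
    SatB c = (a : Dom n) → holdsA M (ConjB.γ c) (single a) →
      Σ (Dom n) λ b → holdsA M (ConjB.θ c) (pair a b) × holdsQ M (ConjB.ψ c) (pair a b)

    SatC : ConjC → Set
    SatC c = (v : Fin (ConjC.k c) → Dom n) → holdsA M (ConjC.γ c) v → holdsQ M (ConjC.ψ c) v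

    SatD : Set
    SatD = (s : Sym) (xs : Vec (Dom n) (ar s)) → R s xs ≡ true →
      (i j : Fin (ar s)) → R aux (lookup xs i ∷ lookup xs j ∷ []) ≡ true

  _⊨_ : ∀ {n} → Str n → NF → Set
  M ⊨ φ = All (SatA M) (NF.as φ) × All (SatB M) (NF.bs φ) × All (SatC M) (NF.cs φ) × SatD M

  SatForall : ∀ {n} → Str n → NF → Set
  SatForall M φ = All (SatC M) (NF.cs φ) × SatD M

  HasFinModel : NF → Set
  HasFinModel φ = ∃ λ n → Σ (Str n) λ M → Transitive M × M ⊨ φ

  -- ℓ-types: maximal consistent sets of (negated) atoms in x_1..x_ℓ,
  -- represented as a total truth assignment to the atoms over Fin ℓ;
  -- consistency = being realised by some tuple in some structure.

  Type : ℕ → Set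
  Type ℓ = Atom ℓ → Bool

  Realizes : ∀ {n ℓ} → Str n → (Fin ℓ → Dom n) → Type ℓ → Set
  Realizes M v t = ∀ A → tpOf M v A ≡ t A

  IsType : ∀ {ℓ} → Type ℓ → Set
  IsType {ℓ} t = ∃ λ n → Σ (Str n) λ M → Σ (Fin ℓ → Dom n) λ v → Realizes M v t

  NonDegenerate : Type 2 → Set
  NonDegenerate β = β (eq zero (suc zero)) ≡ false

  GuardedType : Type 2 → Set
  GuardedType β = Σ (Atom 2) λ A → β A ≡ true × Mentions A zero × Mentions A (suc zero)

  -- atoms T(x_1,x_2), T(x_2,x_1) with T transitive (removed in β⁻)
  TrCross : Atom 2 → Set
  TrCross (rel (tr T) (i ∷ j ∷ [])) = i ≢ j
  TrCross _                          = ⊥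

  Realizes⁻ : ∀ {n} → Str n → (Fin 2 → Dom n) → Type 2 → Set
  Realizes⁻ M v β = ∀ A → ¬ TrCross A → tpOf M v A ≡ β A

  module _ {n : ℕ} (M : Str n) (αs : List (Type 1)) where
    open Str M

    AlphaPart : Set
    AlphaPart = All (λ α → Σ (Dom n) λ a → Realizes M (single a) α) αs
              × ((a : Dom n) → Any (λ α → Realizes M (single a) α) αs)

  _⊨B[_,_,_] : ∀ {n} → Str n → NF → List (Type 1) → List (Type 2) → Set
  _⊨B[_,_,_] {n} M φ αs βs =
      All (SatA M) (NF.as φ)
    × All (SatC M) (NF.cs φ)
    × SatD M
    × ((T : Fin nTr) (a b : Dom n) → Str.R M (tr T) (a ∷ b ∷ []) ≡ true → a ≡ b)
    × All (λ β → Σ (Dom n) λ a → Σ (Dom n) λ b → Realizes⁻ M (pair a b) β) βs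
    × AlphaPart M αs

  _⊨C[_,_,_] : ∀ {n} → Str n → NF → List (Type 1) → List (Type 2) → Set
  _⊨C[_,_,_] {n} M φ αs βs =
      All (SatB M) (NF.bs φ)
    × All (λ c → UsesTr (ConjC.γ c) → SatC M c) (NF.cs φ)
    × ((s : Sym) (xs : Vec (Fin 2) (ar s)) → zero ∈ᵥ xs → suc zero ∈ᵥ xs →
         (a b : Dom n) → Str.R M s (map (pair a b) xs) ≡ true →
         Str.R M aux (a ∷ b ∷ []) ≡ true)
    × ((a b : Dom n) → Str.R M aux (a ∷ b ∷ []) ≡ true → a ≢ b →
         Any (λ β → Realizes⁻ M (pair a b) β) βs)
    × AlphaPart M αs

  Certificate : NF → Set
  Certificate φ =
    Σ (List (Type 1)) λ αs → Σ (List (Type 2)) λ βs →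
        All IsType αs
      × All (λ β → IsType β × NonDegenerate β × GuardedType β) βs
      × (∃ λ n → Σ (Str n) λ M → Transitive M × M ⊨B[ φ , αs , βs ])
      × (∃ λ n → Σ (Str n) λ M → Transitive M × M ⊨C[ φ , αs , βs ])
      × All (λ β → (M : Str 1) (a b : Dom 1) → a ≢ b →
                   Realizes M (pair a b) β → SatForall M φ) βs

-- Only if: for a finite model M take as α the 1-types of M and as β the 2-types of its Aux-pairs.
-- Cutting the transitive relations of M down to loops gives a model of φ_B, and M itself is a model
-- of φ_C. A two-element structure realising the type of an Aux-pair of M embeds into M, and the
-- ∀-conjuncts, being universal, are preserved under substructures.
--
-- If: from models MB of φ_B and MC of φ_C build a model on the nodes (o , c) with o ∈ (ℤ/3)^D and
-- c ∈ MC. Every component {o} × MC carries the transitive relations of MC. For every component o and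
-- every Aux-pair or loop (c , d) of MC a copy of MB is glued in: a pair of MB with the same
-- transitive-free 2-type as (c , d) (it exists by the β-parts of φ_B and φ_C) goes to (o , c) and
-- (o , d), and every other element b to (o + e_(c,d,b) , c′) with c′ of the same 1-type as b (the
-- α-parts). The non-transitive facts are the images of those of MB under the copies. Two distinct
-- nodes lie in a common shift pattern of at most one base point, and copies at the same base point
-- meet only in their anchored pairs, whose types come from MC; hence the copies never disagree and
-- each copy is an embedding. Conjuncts with non-transitive guards then hold because every guarded
-- tuple lies in a copy of MB, and those with transitive guards because it lies in a component.

module Submission where

open import Defs
open import Data.Nat using (ℕ; zero; suc; _*_; _^_; pred)
open import Data.Nat.Properties using (suc-pred; m*n≢0; m^n≢0)
open import Data.Fin using (Fin; zero; suc; _≟_; combine; splitAt)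
open import Data.Fin.Properties using (combine-injective; any?; *↔×)
open import Data.Vec as Vec using (Vec; []; _∷_; map; lookup; updateAt; allFin)
open import Data.Vec.Properties using (map-∘; map-cong; map-id; lookup-map; map-lookup-allFin; lookup∘updateAt; lookup∘updateAt′; tabulate∘lookup; tabulate-cong)
import Data.Vec.Properties as Vecₚ
open import Data.Vec.Membership.Propositional using () renaming (_∈_ to _∈ᵥ_)
open import Data.Vec.Relation.Unary.Any using (here; there)
import Data.Vec.Relation.Unary.Any as VecAny
import Data.Vec.Relation.Unary.Any.Properties as VecAnyₚ
import Data.Vec.Functional as VF
open import Data.List as List using (List; filter; cartesianProduct)
open import Data.List.Relation.Unary.All as All using (All)
import Data.List.Relation.Unary.All.Properties as Allₚ
open import Data.List.Relation.Unary.Any using (Any)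
import Data.List.Relation.Unary.Any.Properties as Anyₚ
open import Data.List.Membership.Propositional using (lose)
open import Data.List.Membership.Propositional.Properties using (∈-map⁻; ∈-map⁺; ∈-filter⁻; ∈-filter⁺; ∈-cartesianProduct⁺; ∈-allFin)
open import Data.Maybe using (Maybe; just; nothing)
import Data.Maybe.Properties as Maybeₚ
open import Data.Bool using (Bool; true; false; _∧_)
open import Data.Bool.Properties using (∧-identityʳ) renaming (_≟_ to _≟ᵇ_)
open import Data.Product using (Σ; ∃; _×_; _,_; proj₁; proj₂; uncurry)
import Data.Product.Properties as Productₚ
open import Data.Product.Function.NonDependent.Propositional using (_×-⇔_; _×-↔_)
open import Data.Sum using (_⊎_; inj₁; inj₂)
open import Data.Sum.Function.Propositional using (_⊎-⇔_)
open import Data.Empty using (⊥; ⊥-elim)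
open import Data.Unit using (⊤; tt)
open import Function using (id; _∘_; const; case_of_)
open import Function.Bundles using (_↔_; _⇔_; mk⇔; mk↔ₛ′; Inverse; Equivalence)
open import Function.Construct.Identity using (⇔-id)
open import Function.Properties.Inverse using (↔-refl; ↔-sym; ↔-trans)
open import Function.Related.TypeIsomorphisms using (¬-cong-⇔; →-cong-⇔)
open import Relation.Binary.Definitions using (DecidableEquality)
open import Relation.Binary.PropositionalEquality
open ≡-Reasoning
open import Relation.Nullary using (¬_; yes; no; Dec)
open import Relation.Nullary.Decidable using (⌊_⌋; _×-dec_; ¬?; map′)

⌊⌋-true : ∀ {P : Set} (d : Dec P) → P → ⌊ d ⌋ ≡ true
⌊⌋-true (yes _) _ = refl
⌊⌋-true (no ¬p) p = ⊥-elim (¬p p)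

⌊⌋-false : ∀ {P : Set} (d : Dec P) → ¬ P → ⌊ d ⌋ ≡ false
⌊⌋-false (yes p) ¬p = ⊥-elim (¬p p)
⌊⌋-false (no _)  _  = refl

⌊⌋-witness : ∀ {P : Set} (d : Dec P) → ⌊ d ⌋ ≡ true → P
⌊⌋-witness (yes p) _ = p

⌊⌋-cong : ∀ {P Q : Set} → P ⇔ Q → (p? : Dec P) (q? : Dec Q) → ⌊ p? ⌋ ≡ ⌊ q? ⌋
⌊⌋-cong P⇔Q (yes p) q? = sym (⌊⌋-true q? (Equivalence.to P⇔Q p))
⌊⌋-cong P⇔Q (no ¬p) q? = sym (⌊⌋-false q? (¬p ∘ Equivalence.from P⇔Q))

++-cong : ∀ {A B C : Set} {k m} (f : A → C) (g : B → C) {v : Fin k → A} {w : Fin m → A} {v′ w′} →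
  (∀ i → f (v i) ≡ g (v′ i)) → (∀ i → f (w i) ≡ g (w′ i)) → ∀ i → f ((v VF.++ w) i) ≡ g ((v′ VF.++ w′) i)
++-cong {k = k} f g v≗ w≗ i with splitAt k i
... | inj₁ l = v≗ l
... | inj₂ l = w≗ l

any-Vec? : ∀ {m} ℓ {P : Vec (Fin m) ℓ → Set} → (∀ v → Dec (P v)) → Dec (∃ P)
any-Vec? zero    P? = map′ ([] ,_) (λ { ([] , p) → p }) (P? [])
any-Vec? (suc ℓ) P? = map′ (λ { (x , v , p) → x ∷ v , p }) (λ { (x ∷ v , p) → x , v , p })
  (any? λ x → any-Vec? ℓ (P? ∘ (x ∷_)))

Fin2-other : ∀ (x y z : Fin 2) → x ≢ y → z ≢ x → y ≡ z
Fin2-other zero       (suc zero) (suc zero) _   _   = refl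
Fin2-other (suc zero) zero       zero       _   _   = refl
Fin2-other zero       zero       _          x≢y _   = ⊥-elim (x≢y refl)
Fin2-other (suc zero) (suc zero) _          x≢y _   = ⊥-elim (x≢y refl)
Fin2-other zero       (suc zero) zero       _   z≢x = ⊥-elim (z≢x refl)
Fin2-other (suc zero) zero       (suc zero) _   z≢x = ⊥-elim (z≢x refl)

∷↔× : ∀ {A : Set} {n} → Vec A (suc n) ↔ (A × Vec A n)
∷↔× = mk↔ₛ′ (λ { (x ∷ xs) → x , xs }) (uncurry _∷_) (λ _ → refl) (λ { (x ∷ xs) → refl })

Vec↔Fin^ : ∀ {m} n → Vec (Fin m) n ↔ Fin (m ^ n)
Vec↔Fin^ zero    = mk↔ₛ′ (λ _ → zero) (λ _ → []) (λ { zero → refl }) (λ { [] → refl })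
Vec↔Fin^ (suc n) = ↔-trans ∷↔× (↔-trans (↔-refl ×-↔ Vec↔Fin^ n) (↔-sym *↔×))

Fin-cong : ∀ {m n} → m ≡ n → Fin m ↔ Fin n
Fin-cong refl = ↔-refl

-- Shifts in (ℤ/3)^D

rotate : Fin 3 → Fin 3
rotate zero             = suc zero
rotate (suc zero)       = suc (suc zero)
rotate (suc (suc zero)) = zero

rotate³ : ∀ p → rotate (rotate (rotate p)) ≡ p
rotate³ zero             = refl
rotate³ (suc zero)       = refl
rotate³ (suc (suc zero)) = refl

rotate-injective : ∀ p q → rotate p ≡ rotate q → p ≡ q
rotate-injective p q e = trans (sym (rotate³ p)) (trans (cong (λ r → rotate (rotate r)) e) (rotate³ q))

rotate-no-fixpoint : ∀ p → rotate p ≢ p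
rotate-no-fixpoint zero ()
rotate-no-fixpoint (suc zero) ()
rotate-no-fixpoint (suc (suc zero)) ()

rotate²-no-fixpoint : ∀ p → rotate (rotate p) ≢ p
rotate²-no-fixpoint zero ()
rotate²-no-fixpoint (suc zero) ()
rotate²-no-fixpoint (suc (suc zero)) ()

module Grid (D : ℕ) where

  Point : Set
  Point = Vec (Fin 3) D

  shift : Point → Maybe (Fin D) → Point
  shift o nothing  = o
  shift o (just a) = updateAt o a rotate

  step : Maybe (Fin D) → Fin D → Fin 3 → Fin 3
  step nothing  i = id
  step (just a) i with a ≟ i
  ... | yes _ = rotate
  ... | no  _ = id

  lookup-shift : ∀ o ε i → lookup (shift o ε) i ≡ step ε i (lookup o i)
  lookup-shift o nothing  i = refl
  lookup-shift o (just a) i with a ≟ i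
  ... | yes refl = lookup∘updateAt a o
  ... | no  a≢i  = lookup∘updateAt′ i a (a≢i ∘ sym) o

  step-hit : ∀ a p → step (just a) a p ≡ rotate p
  step-hit a p with a ≟ a
  ... | yes _ = refl
  ... | no a≢a = ⊥-elim (a≢a refl)

  step-miss : ∀ ε a p → ε ≢ just a → step ε a p ≡ p
  step-miss nothing  a p _ = refl
  step-miss (just b) a p b≢a with b ≟ a
  ... | yes refl = ⊥-elim (b≢a refl)
  ... | no  _    = refl

  step-injective : ∀ ε i p q → step ε i p ≡ step ε i q → p ≡ q
  step-injective nothing  i p q e = e
  step-injective (just a) i p q e with a ≟ i
  ... | yes _ = rotate-injective p q e
  ... | no  _ = e

  step-hits : ∀ ε ε′ a p q → rotate p ≡ step ε a q → p ≡ step ε′ a q → ε ≡ just a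
  step-hits ε ε′ a p q e e′ with Maybeₚ.≡-dec _≟_ ε (just a) | Maybeₚ.≡-dec _≟_ ε′ (just a)
  ... | yes ε≡ | _        = ε≡
  ... | no ε≢  | yes refl = ⊥-elim (rotate²-no-fixpoint p (sym (begin
    p                      ≡⟨ e′ ⟩
    step (just a) a q      ≡⟨ step-hit a q ⟩
    rotate q               ≡⟨ cong rotate (sym (trans e (step-miss ε a q ε≢))) ⟩
    rotate (rotate p)      ∎)))
  ... | no ε≢  | no ε′≢   = ⊥-elim (rotate-no-fixpoint p
    (trans e (trans (step-miss ε a q ε≢) (sym (trans e′ (step-miss ε′ a q ε′≢))))))

  shifted-coordinate : ∀ o o′ ε ε′ → shift o ε ≡ shift o′ ε′ →
    ∀ i → step ε i (lookup o i) ≡ step ε′ i (lookup o′ i)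
  shifted-coordinate o o′ ε ε′ e i =
    trans (sym (lookup-shift o ε i)) (trans (cong (λ p → lookup p i) e) (lookup-shift o′ ε′ i))

  shift-injectiveˡ : ∀ o o′ ε → shift o ε ≡ shift o′ ε → o ≡ o′
  shift-injectiveˡ o o′ ε e = begin
    o                     ≡⟨ sym (tabulate∘lookup o) ⟩
    Vec.tabulate (lookup o)   ≡⟨ tabulate-cong (λ i → step-injective ε i _ _ (shifted-coordinate o o′ ε ε e i)) ⟩
    Vec.tabulate (lookup o′)  ≡⟨ tabulate∘lookup o′ ⟩
    o′                    ∎

  shift-injectiveʳ : ∀ o ε ε′ → shift o ε ≡ shift o ε′ → ε ≡ ε′
  shift-injectiveʳ o nothing  nothing  e = refl
  shift-injectiveʳ o (just a) ε′       e = sym (step-hits ε′ nothing a (lookup o a) (lookup o a)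
    (trans (sym (step-hit a _)) (shifted-coordinate o o (just a) ε′ e a)) refl)
  shift-injectiveʳ o nothing  (just a) e = sym (shift-injectiveʳ o (just a) nothing (sym e))

  shift-just-base-unique : ∀ o o′ a ε ε₁′ ε₂′ → ε ≢ just a →
    shift o (just a) ≡ shift o′ ε₁′ → shift o ε ≡ shift o′ ε₂′ → o ≡ o′
  shift-just-base-unique o o′ a ε ε₁′ ε₂′ ε≢ e₁ e₂ with step-hits ε₁′ ε₂′ a (lookup o a) (lookup o′ a)
    (trans (sym (step-hit a _)) (shifted-coordinate o o′ (just a) ε₁′ e₁ a))
    (trans (sym (step-miss ε a _ ε≢)) (shifted-coordinate o o′ ε ε₂′ e₂ a))
  ... | refl = shift-injectiveˡ o o′ (just a) e₁

  -- Shifting modulo 2 would not do: o and o + e_a + e_b would share the shifts o + e_a and o + e_b.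
  shift-base-unique : ∀ o o′ ε₁ ε₂ ε₁′ ε₂′ → ε₁ ≢ ε₂ →
    shift o ε₁ ≡ shift o′ ε₁′ → shift o ε₂ ≡ shift o′ ε₂′ → o ≡ o′
  shift-base-unique o o′ (just a) ε₂ ε₁′ ε₂′ ε₁≢ε₂ e₁ e₂ =
    shift-just-base-unique o o′ a ε₂ ε₁′ ε₂′ (ε₁≢ε₂ ∘ sym) e₁ e₂
  shift-base-unique o o′ nothing (just a) ε₁′ ε₂′ _ e₁ e₂ =
    shift-just-base-unique o o′ a nothing ε₂′ ε₁′ (λ ()) e₂ e₁
  shift-base-unique o o′ nothing nothing ε₁′ ε₂′ ε₁≢ε₂ _ _ = ⊥-elim (ε₁≢ε₂ refl)

-- Types of tuples

module Semantics (σ : Signature) where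

  renameAtom : ∀ {k l} → (Fin k → Fin l) → Atom σ k → Atom σ l
  renameAtom g (rel s xs) = rel s (map g xs)
  renameAtom g (eq i j)   = eq (g i) (g j)

  NoTrA-rename : ∀ {k l} (g : Fin k → Fin l) (A : Atom σ k) → NoTrA σ A → NoTrA σ (renameAtom g A)
  NoTrA-rename g (rel (nt _) _) _ = tt
  NoTrA-rename g (rel aux _)    _ = tt
  NoTrA-rename g (eq _ _)       _ = tt

  NoTrA⇒¬TrCross : (A : Atom σ 2) → NoTrA σ A → ¬ TrCross σ A
  NoTrA⇒¬TrCross (rel (nt _) _) _ ()
  NoTrA⇒¬TrCross (rel aux _)    _ ()
  NoTrA⇒¬TrCross (eq _ _)       _ ()

  ¬TrCross-const : ∀ {k} (z : Fin 2) (A : Atom σ k) → ¬ TrCross σ (renameAtom (const z) A)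
  ¬TrCross-const z (rel (tr _) (_ ∷ _ ∷ [])) z≢z = z≢z refl
  ¬TrCross-const z (rel (nt _) _) ()
  ¬TrCross-const z (rel aux _)    ()
  ¬TrCross-const z (eq _ _)       ()

  module _ {n : ℕ} (M : Str σ n) where

    tpOf-rename : ∀ {k l} {v : Fin k → Dom σ n} {w : Fin l → Dom σ n} (g : Fin k → Fin l) →
      (∀ i → v i ≡ w (g i)) → ∀ A → tpOf σ M v A ≡ tpOf σ M w (renameAtom g A)
    tpOf-rename {v = v} {w} g v≗w∘g (rel s xs) =
      cong (Str.R M s) (trans (map-cong v≗w∘g xs) (map-∘ w g xs))
    tpOf-rename g v≗w∘g (eq i j) rewrite v≗w∘g i | v≗w∘g j = refl

    tpOf-cong : ∀ {k} {v w : Fin k → Dom σ n} → (∀ i → v i ≡ w i) → ∀ A → tpOf σ M v A ≡ tpOf σ M w A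
    tpOf-cong v≗w (rel s xs) = cong (Str.R M s) (map-cong v≗w xs)
    tpOf-cong v≗w (eq i j) rewrite v≗w i | v≗w j = refl

    holdsA⇔tpOf : ∀ {k} (A : Atom σ k) v → holdsA σ M A v ⇔ (tpOf σ M v A ≡ true)
    holdsA⇔tpOf (rel s xs) v = ⇔-id _
    holdsA⇔tpOf (eq i j)   v with v i ≟ v j
    ... | yes vi≡vj = mk⇔ (λ _ → refl) (λ _ → vi≡vj)
    ... | no  vi≢vj = mk⇔ (λ vi≡vj → ⊥-elim (vi≢vj vi≡vj)) (λ ())

  module _ {m n : ℕ} (M : Str σ m) (N : Str σ n) where

    holdsA-cong : ∀ {k} {v w} (A : Atom σ k) → tpOf σ M v A ≡ tpOf σ N w A →
      holdsA σ M A v ⇔ holdsA σ N A w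
    holdsA-cong {v = v} {w} A e = mk⇔
      (λ h → Equivalence.from (holdsA⇔tpOf N A w) (trans (sym e) (Equivalence.to (holdsA⇔tpOf M A v) h)))
      (λ h → Equivalence.from (holdsA⇔tpOf M A v) (trans e (Equivalence.to (holdsA⇔tpOf N A w) h)))

    holdsA-transfer : ∀ {k} {v w} (A : Atom σ k) → tpOf σ M v A ≡ tpOf σ N w A →
      holdsA σ M A v → holdsA σ N A w
    holdsA-transfer A e = Equivalence.to (holdsA-cong A e)

    holdsQ-cong : ∀ {k} {v w} → (∀ A → NoTrA σ A → tpOf σ M v A ≡ tpOf σ N w A) →
      (ψ : QF σ k) → NoTr σ ψ → holdsQ σ M ψ v ⇔ holdsQ σ N ψ w
    holdsQ-cong ag (atm A)  q       = holdsA-cong A (ag A q)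
    holdsQ-cong ag ⊤q       _       = ⇔-id _
    holdsQ-cong ag ⊥q       _       = ⇔-id _
    holdsQ-cong ag (¬q ψ)   q       = ¬-cong-⇔ (holdsQ-cong ag ψ q)
    holdsQ-cong ag (ψ ∧q χ) (p , q) = holdsQ-cong ag ψ p ×-⇔ holdsQ-cong ag χ q
    holdsQ-cong ag (ψ ∨q χ) (p , q) = holdsQ-cong ag ψ p ⊎-⇔ holdsQ-cong ag χ q
    holdsQ-cong ag (ψ ⇒q χ) (p , q) = →-cong-⇔ (holdsQ-cong ag ψ p) (holdsQ-cong ag χ q)

    holdsQ-transfer : ∀ {k} {v w} → (∀ A → NoTrA σ A → tpOf σ M v A ≡ tpOf σ N w A) →
      (ψ : QF σ k) → NoTr σ ψ → holdsQ σ M ψ v → holdsQ σ N ψ w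
    holdsQ-transfer ag ψ q = Equivalence.to (holdsQ-cong ag ψ q)

    tpOf-factor-agree : ∀ {j k} {P : Atom σ j → Set} {w w′ u u′} →
      (∀ B → P B → tpOf σ M w B ≡ tpOf σ N w′ B) → (g : Fin k → Fin j) →
      (∀ i → u i ≡ w (g i)) → (∀ i → u′ i ≡ w′ (g i)) →
      ∀ A → P (renameAtom g A) → tpOf σ M u A ≡ tpOf σ N u′ A
    tpOf-factor-agree ag g u≗ u′≗ A p =
      trans (tpOf-rename M g u≗ A) (trans (ag _ p) (sym (tpOf-rename N g u′≗ A)))

    tpOf-pair-agree : ∀ {k} {P : Atom σ 2 → Set} {a b c d} {u : Fin k → Dom σ m} {u′ : Fin k → Dom σ n} →
      (∀ B → P B → tpOf σ M (pair σ a b) B ≡ tpOf σ N (pair σ c d) B) →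
      (∀ i → (u i ≡ a × u′ i ≡ c) ⊎ (u i ≡ b × u′ i ≡ d)) →
      ∀ A → (∀ g → P (renameAtom g A)) → tpOf σ M u A ≡ tpOf σ N u′ A
    tpOf-pair-agree {u = u} {u′} ag side A p = tpOf-factor-agree ag g u≗ u′≗ A (p g)
      where
      g : _ → Fin 2
      g i with side i
      ... | inj₁ _ = zero
      ... | inj₂ _ = suc zero
      u≗ : ∀ i → u i ≡ pair σ _ _ (g i)
      u≗ i with side i
      ... | inj₁ (e , _) = e
      ... | inj₂ (e , _) = e
      u′≗ : ∀ i → u′ i ≡ pair σ _ _ (g i)
      u′≗ i with side i
      ... | inj₁ (_ , e) = e
      ... | inj₂ (_ , e) = e

  record IsEmbedding {m n} (M′ : Str σ m) (M : Str σ n) (h : Dom σ m → Dom σ n) : Set where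
    field
      injective : ∀ x y → h x ≡ h y → x ≡ y
      preserves : ∀ s xs → Str.R M′ s xs ≡ Str.R M s (map h xs)

  module _ {m n} {M′ : Str σ m} {M : Str σ n} {h : Dom σ m → Dom σ n} (emb : IsEmbedding M′ M h) where
    open IsEmbedding emb

    tpOf-embedding : ∀ {k} (v : Fin k → Dom σ m) A → tpOf σ M′ v A ≡ tpOf σ M (h ∘ v) A
    tpOf-embedding v (rel s xs) = trans (preserves s (map v xs)) (cong (Str.R M s) (sym (map-∘ h v xs)))
    tpOf-embedding v (eq i j) = ⌊⌋-cong (mk⇔ (cong h) (injective _ _)) _ _

    SatC-reflect : ∀ c → SatC σ M c → SatC σ M′ c
    SatC-reflect c sat v γ-holds = holdsQ-transfer M M′ (λ A _ → sym (tpOf-embedding v A)) (ConjC.ψ c) (ConjC.ψ-ntr c)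
      (sat (h ∘ v) (holdsA-transfer M′ M (ConjC.γ c) (tpOf-embedding v (ConjC.γ c)) γ-holds))

    SatD-reflect : SatD σ M → SatD σ M′
    SatD-reflect satD s xs r i j = trans (preserves aux (lookup xs i ∷ lookup xs j ∷ []))
      (subst₂ (λ x y → Str.R M aux (x ∷ y ∷ []) ≡ true) (lookup-map i h xs) (lookup-map j h xs)
        (satD s (map h xs) (trans (sym (preserves s xs)) r) i j))

    SatForall-reflect : ∀ φ → SatForall σ M φ → SatForall σ M′ φ
    SatForall-reflect φ (satC , satD) = All.map (λ {c} → SatC-reflect c) satC , SatD-reflect satD

  realizes-embedding : ∀ {k m n} {M′ : Str σ m} {M : Str σ n} (w : Fin k → Dom σ m) (u : Fin k → Dom σ n)
    (sec : Dom σ m → Fin k) → (∀ z → w (sec z) ≡ z) → (∀ A → tpOf σ M′ w A ≡ tpOf σ M u A) →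
    IsEmbedding M′ M (u ∘ sec)
  realizes-embedding {M′ = M′} {M} w u sec w∘sec≗id same = record
    { injective = λ x y e → trans (sym (w∘sec≗id x)) (trans
        (holdsA-transfer M M′ {v = u} {w = w} (eq (sec x) (sec y)) (sym (same (eq (sec x) (sec y)))) e) (w∘sec≗id y))
    ; preserves = λ s xs → begin
        Str.R M′ s xs                       ≡⟨ cong (Str.R M′ s) (sym (map-id xs)) ⟩
        tpOf σ M′ (λ z → z) (rel s xs)       ≡⟨ tpOf-rename M′ sec (λ z → sym (w∘sec≗id z)) (rel s xs) ⟩
        tpOf σ M′ w (rel s (map sec xs))     ≡⟨ same (rel s (map sec xs)) ⟩
        tpOf σ M u (rel s (map sec xs))      ≡⟨ sym (tpOf-rename M sec (λ _ → refl) (rel s xs)) ⟩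
        Str.R M s (map (u ∘ sec) xs)         ∎ }
    

  pair-diagonal : ∀ {D : Set} (x : D) (i : Fin 2) → pair σ x x i ≡ x
  pair-diagonal x zero       = refl
  pair-diagonal x (suc zero) = refl

  same-type₁ : ∀ {m n} {M : Str σ m} {N : Str σ n} {αs} → AlphaPart σ M αs → AlphaPart σ N αs →
    (a : Dom σ m) → Σ (Dom σ n) λ b → ∀ A → tpOf σ M (single σ a) A ≡ tpOf σ N (single σ b) A
  same-type₁ (_ , M-covered) (N-realizes , _) a with All.lookupAny N-realizes (M-covered a)
  ... | (b , N-real) , M-real = b , λ A → trans (M-real A) (sym (N-real A))

module OnCarrier (σ : Signature) {X : Set} (_≟X_ : DecidableEquality X) {n : ℕ} (code : X ↔ Fin (suc n))
                 (R : (s : Sym σ) → Vec X (ar σ s) → Bool) where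
  open Inverse code using (to; from; strictlyInverseˡ)

  tpX : ∀ {k} → (Fin k → X) → Atom σ k → Bool
  tpX v (rel s xs) = R s (map v xs)
  tpX v (eq i j)   = ⌊ v i ≟X v j ⌋

  tpX-cong : ∀ {k} {v w : Fin k → X} → (∀ i → v i ≡ w i) → ∀ A → tpX v A ≡ tpX w A
  tpX-cong v≗w (rel s xs) = cong (R s) (map-cong v≗w xs)
  tpX-cong v≗w (eq i j) rewrite v≗w i | v≗w j = refl

  structure : Str σ n
  structure = record { R = λ s xs → R s (map from xs) }

  tpOf-structure : ∀ {k} (v : Fin k → Dom σ n) A → tpOf σ structure v A ≡ tpX (from ∘ v) A
  tpOf-structure v (rel s xs) = cong (R s) (sym (map-∘ from v xs))
  tpOf-structure v (eq i j) = ⌊⌋-cong (mk⇔ (cong from) from-injective) _ _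
    where
    from-injective : from (v i) ≡ from (v j) → v i ≡ v j
    from-injective e = trans (sym (strictlyInverseˡ (v i))) (trans (cong to e) (strictlyInverseˡ (v j)))

-- From a finite model to a certificate

module Diagonal (σ : Signature) {n : ℕ} (M : Str σ n) where
  open Semantics σ

  diagonalR : (s : Sym σ) → Vec (Dom σ n) (ar σ s) → Bool
  diagonalR (tr T) (a ∷ b ∷ []) = Str.R M (tr T) (a ∷ b ∷ []) ∧ ⌊ a ≟ b ⌋
  diagonalR (nt P) xs = Str.R M (nt P) xs
  diagonalR aux    xs = Str.R M aux xs

  diagonal : Str σ n
  diagonal = record { R = diagonalR }

  diagonal⊆ : ∀ s xs → diagonalR s xs ≡ true → Str.R M s xs ≡ true
  diagonal⊆ (tr T) (a ∷ b ∷ []) h with Str.R M (tr T) (a ∷ b ∷ [])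
  ... | true = refl
  diagonal⊆ (nt P) xs h = h
  diagonal⊆ aux    xs h = h

  diagonal-loop : ∀ T a b → diagonalR (tr T) (a ∷ b ∷ []) ≡ true → a ≡ b
  diagonal-loop T a b h with Str.R M (tr T) (a ∷ b ∷ []) | a ≟ b
  ... | true | yes a≡b = a≡b

  diagonal-transitive : Transitive σ diagonal
  diagonal-transitive T a b c h₁ h₂ with diagonal-loop T a b h₁ | diagonal-loop T b c h₂
  ... | refl | refl = h₁

  OnDiagonal : ∀ {k} → (Fin k → Dom σ n) → Atom σ k → Set
  OnDiagonal v (rel (tr T) (i ∷ j ∷ [])) = v i ≡ v j
  OnDiagonal v (rel (nt _) _) = ⊤
  OnDiagonal v (rel aux _)    = ⊤
  OnDiagonal v (eq _ _)       = ⊤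

  tpOf-diagonal : ∀ {k} (v : Fin k → Dom σ n) A → OnDiagonal v A → tpOf σ diagonal v A ≡ tpOf σ M v A
  tpOf-diagonal v (rel (tr T) (i ∷ j ∷ [])) vi≡vj rewrite vi≡vj with v j ≟ v j
  ... | yes _    = ∧-identityʳ _
  ... | no vj≢vj = ⊥-elim (vj≢vj refl)
  tpOf-diagonal v (rel (nt _) _) _ = refl
  tpOf-diagonal v (rel aux _)    _ = refl
  tpOf-diagonal v (eq _ _)       _ = refl

  NoTrA⇒OnDiagonal : ∀ {k} (v : Fin k → Dom σ n) A → NoTrA σ A → OnDiagonal v A
  NoTrA⇒OnDiagonal v (rel (nt _) _) _ = tt
  NoTrA⇒OnDiagonal v (rel aux _)    _ = tt
  NoTrA⇒OnDiagonal v (eq _ _)       _ = tt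

  single-OnDiagonal : ∀ a (A : Atom σ 1) → OnDiagonal (single σ a) A
  single-OnDiagonal a (rel (tr T) (_ ∷ _ ∷ [])) = refl
  single-OnDiagonal a (rel (nt _) _) = tt
  single-OnDiagonal a (rel aux _)    = tt
  single-OnDiagonal a (eq _ _)       = tt

  pair-OnDiagonal : ∀ a b (A : Atom σ 2) → ¬ TrCross σ A → OnDiagonal (pair σ a b) A
  pair-OnDiagonal a b (rel (tr T) (i ∷ j ∷ [])) ¬cross with i ≟ j
  ... | yes refl = refl
  ... | no i≢j   = ⊥-elim (¬cross i≢j)
  pair-OnDiagonal a b (rel (nt _) _) _ = tt
  pair-OnDiagonal a b (rel aux _)    _ = tt
  pair-OnDiagonal a b (eq _ _)       _ = tt

  tpOf-diagonal-NoTrA : ∀ {k} (v : Fin k → Dom σ n) A → NoTrA σ A → tpOf σ diagonal v A ≡ tpOf σ M v A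
  tpOf-diagonal-NoTrA v A q = tpOf-diagonal v A (NoTrA⇒OnDiagonal v A q)

  holdsA-diagonal⊆ : ∀ {k} (A : Atom σ k) (v : Fin k → Dom σ n) → holdsA σ diagonal A v → holdsA σ M A v
  holdsA-diagonal⊆ (rel s xs) v = diagonal⊆ s (map v xs)
  holdsA-diagonal⊆ (eq i j)   v h = h

  diagonal-SatA : ∀ c → SatA σ M c → SatA σ diagonal c
  diagonal-SatA c sat v γ-holds
    with sat v (holdsA-transfer diagonal M (ConjA.γ c) (tpOf-diagonal-NoTrA v _ (ConjA.γ-ntr c)) γ-holds)
  ... | w , ϑ-holds , ψ-holds =
    w , holdsA-transfer M diagonal (ConjA.ϑ c) (sym (tpOf-diagonal-NoTrA _ _ (ConjA.ϑ-ntr c))) ϑ-holds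
      , holdsQ-transfer M diagonal (λ A q → sym (tpOf-diagonal-NoTrA _ A q)) (ConjA.ψ c) (ConjA.ψ-ntr c) ψ-holds

  diagonal-SatC : ∀ c → SatC σ M c → SatC σ diagonal c
  diagonal-SatC c sat v γ-holds = holdsQ-transfer M diagonal (λ A q → sym (tpOf-diagonal-NoTrA v A q))
    (ConjC.ψ c) (ConjC.ψ-ntr c) (sat v (holdsA-diagonal⊆ (ConjC.γ c) v γ-holds))

  diagonal-SatD : SatD σ M → SatD σ diagonal
  diagonal-SatD satD s xs r = satD s xs (diagonal⊆ s xs r)

module FromFiniteModel (σ : Signature) (φ : NF σ) {n : ℕ} (M : Str σ n)
                       (M-transitive : Transitive σ M) (M⊨φ : _⊨_ σ M φ) where
  open Semantics σ
  open Diagonal σ M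

  private
    D = Dom σ n
    R = Str.R M

  type₁ : D → Type σ 1
  type₁ a = tpOf σ M (single σ a)

  type₂ : D → D → Type σ 2
  type₂ a b = tpOf σ M (pair σ a b)

  AuxPair : D → D → Set
  AuxPair a b = a ≢ b × R aux (a ∷ b ∷ []) ≡ true

  auxPair? : ∀ a b → Dec (AuxPair a b)
  auxPair? a b = ¬? (a ≟ b) ×-dec (R aux (a ∷ b ∷ []) ≟ᵇ true)

  allPairs : List (D × D)
  allPairs = cartesianProduct (List.allFin _) (List.allFin _)

  auxPairs : List (D × D)
  auxPairs = filter (uncurry auxPair?) allPairs

  αs : List (Type σ 1)
  αs = List.tabulate type₁

  βs : List (Type σ 2)
  βs = List.map (uncurry type₂) auxPairs

  All-βs : ∀ {P : Type σ 2 → Set} → (∀ a b → AuxPair a b → P (type₂ a b)) → All P βs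
  All-βs f = All.tabulate λ β∈ → case ∈-map⁻ (uncurry type₂) β∈ of
    λ { ((a , b) , ab∈ , refl) → f a b (proj₂ (∈-filter⁻ (uncurry auxPair?) {xs = allPairs} ab∈)) }

  Any-βs : ∀ {P : Type σ 2 → Set} {a b} → AuxPair a b → P (type₂ a b) → Any P βs
  Any-βs {a = a} {b} ab p = lose (∈-map⁺ (uncurry type₂)
    (∈-filter⁺ (uncurry auxPair?) (∈-cartesianProduct⁺ (∈-allFin a) (∈-allFin b)) ab)) p

  private
    M-satA = proj₁ M⊨φ
    M-satB = proj₁ (proj₂ M⊨φ)
    M-satC = proj₁ (proj₂ (proj₂ M⊨φ))
    M-satD = proj₂ (proj₂ (proj₂ M⊨φ))

  realizes-types₁ : (N : Str σ n) → (∀ a A → tpOf σ N (single σ a) A ≡ type₁ a A) → AlphaPart σ N αs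
  realizes-types₁ N same =
    Allₚ.tabulate⁺ {f = type₁} (λ a → a , same a) , λ a → Anyₚ.tabulate⁺ {f = type₁} a (same a)

  diagonal⊨B : _⊨B[_,_,_] σ diagonal φ αs βs
  diagonal⊨B = All.map (λ {c} → diagonal-SatA c) M-satA
              , All.map (λ {c} → diagonal-SatC c) M-satC
              , diagonal-SatD M-satD
              , diagonal-loop
              , All-βs (λ a b _ → a , b , λ A ¬cross → tpOf-diagonal (pair σ a b) A (pair-OnDiagonal a b A ¬cross))
              , realizes-types₁ diagonal (λ a A → tpOf-diagonal (single σ a) A (single-OnDiagonal a A))

  aux-closed : ∀ s (xs : Vec (Fin 2) (ar σ s)) → zero ∈ᵥ xs → suc zero ∈ᵥ xs →
    ∀ a b → R s (map (pair σ a b) xs) ≡ true → R aux (a ∷ b ∷ []) ≡ true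
  aux-closed s xs 0∈xs 1∈xs a b r = subst₂ (λ x y → R aux (x ∷ y ∷ []) ≡ true)
    (trans (lookup-map i (pair σ a b) xs) (cong (pair σ a b) (sym (VecAnyₚ.lookup-index 0∈xs))))
    (trans (lookup-map j (pair σ a b) xs) (cong (pair σ a b) (sym (VecAnyₚ.lookup-index 1∈xs))))
    (M-satD s _ r i j)
    where
    i = VecAny.index 0∈xs
    j = VecAny.index 1∈xs

  M⊨C : _⊨C[_,_,_] σ M φ αs βs
  M⊨C = M-satB
       , All.map (λ sat _ → sat) M-satC
       , aux-closed
       , (λ a b r a≢b → Any-βs (a≢b , r) (λ _ _ → refl))
       , realizes-types₁ M (λ _ _ → refl)

  two-element-SatForall : ∀ a b (M′ : Str σ 1) x y → x ≢ y →
    Realizes σ M′ (pair σ x y) (type₂ a b) → SatForall σ M′ φ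
  two-element-SatForall a b M′ x y x≢y real =
    SatForall-reflect (realizes-embedding (pair σ x y) (pair σ a b) index pair-index real) φ (M-satC , M-satD)
    where
    index : Fin 2 → Fin 2
    index z with z ≟ x
    ... | yes _ = zero
    ... | no  _ = suc zero
    pair-index : ∀ z → pair σ x y (index z) ≡ z
    pair-index z with z ≟ x
    ... | yes z≡x = sym z≡x
    ... | no  z≢x = Fin2-other x y z x≢y z≢x

  type₂-nonDegenerate : ∀ a b → a ≢ b → NonDegenerate σ (type₂ a b)
  type₂-nonDegenerate a b a≢b with a ≟ b
  ... | yes a≡b = ⊥-elim (a≢b a≡b)
  ... | no  _   = refl

  certificate : Certificate σ φ
  certificate = αs , βs
    , Allₚ.tabulate⁺ (λ a → n , M , single σ a , λ _ → refl)
    , All-βs (λ a b (a≢b , r) → (n , M , pair σ a b , λ _ → refl)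
                               , type₂-nonDegenerate a b a≢b
                               , rel aux (zero ∷ suc zero ∷ []) , r , here refl , there (here refl))
    , (n , diagonal , diagonal-transitive , diagonal⊨B)
    , (n , M , M-transitive , M⊨C)
    , All-βs (λ a b _ → two-element-SatForall a b)

-- From a certificate to a finite model

module ToFiniteModel (σ : Signature) (φ : NF σ) (αs : List (Type σ 1)) (βs : List (Type σ 2))
  {nB : ℕ} (MB : Str σ nB) (MB⊨ : _⊨B[_,_,_] σ MB φ αs βs)
  {nC : ℕ} (MC : Str σ nC) (MC-transitive : Transitive σ MC) (MC⊨ : _⊨C[_,_,_] σ MC φ αs βs) where
  open Semantics σ

  private
    DB = Dom σ nB
    DC = Dom σ nC
    RB = Str.R MB
    RC = Str.R MC
    MB-satA       = proj₁ MB⊨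
    MB-satC       = proj₁ (proj₂ MB⊨)
    MB-satD       = proj₁ (proj₂ (proj₂ MB⊨))
    MB-βs         = proj₁ (proj₂ (proj₂ (proj₂ (proj₂ MB⊨))))
    MB-αs         = proj₂ (proj₂ (proj₂ (proj₂ (proj₂ MB⊨))))
    MC-satB       = proj₁ MC⊨
    MC-satC       = proj₁ (proj₂ MC⊨)
    MC-aux-closed = proj₁ (proj₂ (proj₂ MC⊨))
    MC-βs         = proj₁ (proj₂ (proj₂ (proj₂ MC⊨)))
    MC-αs         = proj₂ (proj₂ (proj₂ (proj₂ MC⊨)))

  SameType₁ : DB → DC → Set
  SameType₁ b c = ∀ A → tpOf σ MB (single σ b) A ≡ tpOf σ MC (single σ c) A

  toC : DB → DC
  toC b = proj₁ (same-type₁ MB-αs MC-αs b)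

  toC-type₁ : ∀ b → SameType₁ b (toC b)
  toC-type₁ b = proj₂ (same-type₁ MB-αs MC-αs b)

  toB : DC → DB
  toB c = proj₁ (same-type₁ MC-αs MB-αs c)

  toB-type₁ : ∀ c → SameType₁ (toB c) c
  toB-type₁ c A = sym (proj₂ (same-type₁ MC-αs MB-αs c) A)

  SameType⁻ : DB → DB → DC → DC → Set
  SameType⁻ b₁ b₂ c₁ c₂ = ∀ A → ¬ TrCross σ A → tpOf σ MB (pair σ b₁ b₂) A ≡ tpOf σ MC (pair σ c₁ c₂) A

  record Anchor : Set where
    field
      b₁ b₂ : DB
      c₁ c₂ : DC
      same  : SameType⁻ b₁ b₂ c₁ c₂

    first-type₁ : SameType₁ b₁ c₁
    first-type₁ A = tpOf-factor-agree MB MC same (const zero) (λ _ → refl) (λ _ → refl) A (¬TrCross-const zero A)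

    second-type₁ : SameType₁ b₂ c₂
    second-type₁ A = tpOf-factor-agree MB MC same (const (suc zero)) (λ _ → refl) (λ _ → refl) A (¬TrCross-const (suc zero) A)

    b≡⇔c≡ : (b₁ ≡ b₂) ⇔ (c₁ ≡ c₂)
    b≡⇔c≡ = holdsA-cong MB MC {v = pair σ b₁ b₂} {w = pair σ c₁ c₂} (eq zero (suc zero)) (same (eq zero (suc zero)) λ ())

  AuxPairC : DC → DC → Set
  AuxPairC c d = c ≢ d × RC aux (c ∷ d ∷ []) ≡ true

  auxPairC? : ∀ c d → Dec (AuxPairC c d)
  auxPairC? c d = ¬? (c ≟ d) ×-dec (RC aux (c ∷ d ∷ []) ≟ᵇ true)

  Linked : DC → DC → Set
  Linked c d = c ≡ d ⊎ AuxPairC c d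

  auxAnchor : ∀ c d → AuxPairC c d → Anchor
  auxAnchor c d (c≢d , aux-cd) with All.lookupAny MB-βs (MC-βs c d aux-cd c≢d)
  ... | (b₁ , b₂ , B-real) , C-real = record
    { b₁ = b₁ ; b₂ = b₂ ; c₁ = c ; c₂ = d ; same = λ A ¬cross → trans (B-real A ¬cross) (sym (C-real A ¬cross)) }

  loopAnchor : DC → Anchor
  loopAnchor c = record { b₁ = toB c ; b₂ = toB c ; c₁ = c ; c₂ = c
    ; same = λ A _ → tpOf-factor-agree MB MC {P = λ _ → ⊤} (λ B _ → toB-type₁ c B) (const zero)
                       (pair-diagonal _) (pair-diagonal _) A tt }

  -- For a pair that is not linked this is the loop anchor at c, so c₂ is then c, not d.
  anchor : DC → DC → Anchor
  anchor c d with auxPairC? c d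
  ... | yes cd = auxAnchor c d cd
  ... | no  _  = loopAnchor c

  anchor-c₁ : ∀ c d → Anchor.c₁ (anchor c d) ≡ c
  anchor-c₁ c d with auxPairC? c d
  ... | yes (c≢d , aux-cd) with All.lookupAny MB-βs (MC-βs c d aux-cd c≢d)
  ...   | _ = refl
  anchor-c₁ c d | no _ = refl

  anchor-c₂ : ∀ c d → Linked c d → Anchor.c₂ (anchor c d) ≡ d
  anchor-c₂ c d linked with auxPairC? c d
  ... | yes (c≢d , aux-cd) with All.lookupAny MB-βs (MC-βs c d aux-cd c≢d)
  ...   | _ = refl
  anchor-c₂ c d (inj₁ c≡d) | no _    = c≡d
  anchor-c₂ c d (inj₂ cd)  | no ¬cd  = ⊥-elim (¬cd cd)

  AnchoredAs : Anchor → DB → DC → Set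
  AnchoredAs X b l = (b ≡ Anchor.b₁ X × l ≡ Anchor.c₁ X) ⊎ (b ≡ Anchor.b₂ X × l ≡ Anchor.c₂ X)

  anchored-injective : ∀ X {b b′ l l′} → AnchoredAs X b l → AnchoredAs X b′ l′ → l ≡ l′ → b ≡ b′
  anchored-injective X (inj₁ (refl , _)) (inj₁ (refl , _)) _ = refl
  anchored-injective X (inj₂ (refl , _)) (inj₂ (refl , _)) _ = refl
  anchored-injective X (inj₁ (refl , refl)) (inj₂ (refl , refl)) l≡l′ = Equivalence.from (Anchor.b≡⇔c≡ X) l≡l′
  anchored-injective X (inj₂ (refl , refl)) (inj₁ (refl , refl)) l≡l′ = sym (Equivalence.from (Anchor.b≡⇔c≡ X) (sym l≡l′))

  Dim : ℕ
  Dim = (suc nC * suc nC) * suc nB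

  open Grid Dim

  Node : Set
  Node = Point × DC

  -- (o , c , d) names the copy of MB glued onto the nodes (o , c) and (o , d) of component o.
  Copy : Set
  Copy = Point × DC × DC

  base : Copy → Point
  base = proj₁

  anchorOf : Copy → Anchor
  anchorOf (_ , c , d) = anchor c d

  coordinate : DC × DC → DB → Fin Dim
  coordinate (c , d) b = combine (combine c d) b

  coordinate-injective : ∀ κ b κ′ b′ → coordinate κ b ≡ coordinate κ′ b′ → κ ≡ κ′ × b ≡ b′
  coordinate-injective (c , d) b (c′ , d′) b′ e with combine-injective (combine c d) b (combine c′ d′) b′ e
  ... | e′ , refl with combine-injective c d c′ d′ e′
  ...   | refl , refl = refl , refl

  data Place (X : Anchor) (b : DB) : Set where
    first  : b ≡ Anchor.b₁ X → Place X b
    second : b ≡ Anchor.b₂ X → Place X b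
    fresh  : b ≢ Anchor.b₁ X → b ≢ Anchor.b₂ X → Place X b

  place : ∀ X b → Place X b
  place X b with b ≟ Anchor.b₁ X | b ≟ Anchor.b₂ X
  ... | yes b≡b₁ | _        = first b≡b₁
  ... | no  _    | yes b≡b₂ = second b≡b₂
  ... | no  b≢b₁ | no  b≢b₂ = fresh b≢b₁ b≢b₂

  offsetAt : ∀ {X b} → DC × DC → Place X b → Maybe (Fin Dim)
  offsetAt κ (first _)  = nothing
  offsetAt κ (second _) = nothing
  offsetAt {b = b} κ (fresh _ _) = just (coordinate κ b)

  labelAt : ∀ {X b} → Place X b → DC
  labelAt {X} (first _)  = Anchor.c₁ X
  labelAt {X} (second _) = Anchor.c₂ X
  labelAt {b = b} (fresh _ _) = toC b

  offset : Copy → DB → Maybe (Fin Dim)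
  offset K b = offsetAt (proj₂ K) (place (anchorOf K) b)

  label : Copy → DB → DC
  label K b = labelAt (place (anchorOf K) b)

  embed : Copy → DB → Node
  embed K b = shift (base K) (offset K b) , label K b

  offset-nothing : ∀ K b → offset K b ≡ nothing → AnchoredAs (anchorOf K) b (label K b)
  offset-nothing K b _ with place (anchorOf K) b
  ... | first  b≡b₁ = inj₁ (b≡b₁ , refl)
  ... | second b≡b₂ = inj₂ (b≡b₂ , refl)

  offset-just : ∀ K b {x} → offset K b ≡ just x → x ≡ coordinate (proj₂ K) b
  offset-just K b e with place (anchorOf K) b
  offset-just K b refl | fresh _ _ = refl

  offset-just-injective : ∀ K {b b′ x} → offset K b ≡ just x → offset K b′ ≡ just x → b ≡ b′
  offset-just-injective K {b} {b′} e e′ =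
    proj₂ (coordinate-injective (proj₂ K) b (proj₂ K) b′ (trans (sym (offset-just K b e)) (offset-just K b′ e′)))

  label-type₁ : ∀ K b → SameType₁ b (label K b)
  label-type₁ K b with place (anchorOf K) b
  ... | first  refl = Anchor.first-type₁ (anchorOf K)
  ... | second refl = Anchor.second-type₁ (anchorOf K)
  ... | fresh _ _   = toC-type₁ b

  embed-b₁ : ∀ K → embed K (Anchor.b₁ (anchorOf K)) ≡ (base K , Anchor.c₁ (anchorOf K))
  embed-b₁ K with place (anchorOf K) (Anchor.b₁ (anchorOf K))
  ... | first  _     = refl
  ... | second b₁≡b₂ = cong (base K ,_) (sym (Equivalence.to (Anchor.b≡⇔c≡ (anchorOf K)) b₁≡b₂))
  ... | fresh b₁≢b₁ _ = ⊥-elim (b₁≢b₁ refl)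

  embed-b₂ : ∀ K → embed K (Anchor.b₂ (anchorOf K)) ≡ (base K , Anchor.c₂ (anchorOf K))
  embed-b₂ K with place (anchorOf K) (Anchor.b₂ (anchorOf K))
  ... | first  b₂≡b₁ = cong (base K ,_) (Equivalence.to (Anchor.b≡⇔c≡ (anchorOf K)) (sym b₂≡b₁))
  ... | second _     = refl
  ... | fresh _ b₂≢b₂ = ⊥-elim (b₂≢b₂ refl)

  offset-b₁ : ∀ K → offset K (Anchor.b₁ (anchorOf K)) ≡ nothing
  offset-b₁ K with place (anchorOf K) (Anchor.b₁ (anchorOf K))
  ... | first  _ = refl
  ... | second _ = refl
  ... | fresh b₁≢b₁ _ = ⊥-elim (b₁≢b₁ refl)

  offset-b₂ : ∀ K → offset K (Anchor.b₂ (anchorOf K)) ≡ nothing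
  offset-b₂ K with place (anchorOf K) (Anchor.b₂ (anchorOf K))
  ... | first  _ = refl
  ... | second _ = refl
  ... | fresh _ b₂≢b₂ = ⊥-elim (b₂≢b₂ refl)

  embed-injective : ∀ K b b′ → embed K b ≡ embed K b′ → b ≡ b′
  embed-injective K b b′ e = same-offset (offset K b) refl
    where
    offsets≡ : offset K b ≡ offset K b′
    offsets≡ = shift-injectiveʳ (base K) _ _ (cong proj₁ e)
    same-offset : ∀ m → offset K b ≡ m → b ≡ b′
    same-offset (just x) eb = offset-just-injective K eb (trans (sym offsets≡) eb)
    same-offset nothing  eb = anchored-injective (anchorOf K) (offset-nothing K b eb)
      (offset-nothing K b′ (trans (sym offsets≡) eb)) (cong proj₂ e)

  copies-share-base : ∀ K K′ b₁ b₂ b₁′ b₂′ → embed K b₁ ≡ embed K′ b₁′ → embed K b₂ ≡ embed K′ b₂′ →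
    embed K b₁ ≢ embed K b₂ → base K ≡ base K′
  copies-share-base K K′ b₁ b₂ b₁′ b₂′ e₁ e₂ ne with Maybeₚ.≡-dec _≟_ (offset K b₁) (offset K b₂)
  ... | no ε≢ = shift-base-unique (base K) (base K′) (offset K b₁) (offset K b₂) (offset K′ b₁′) (offset K′ b₂′)
    ε≢ (cong proj₁ e₁) (cong proj₁ e₂)
  ... | yes ε≡ = same-offset (offset K b₁) refl
    where
    ε′≡ : offset K′ b₁′ ≡ offset K′ b₂′
    ε′≡ = shift-injectiveʳ (base K′) _ _
      (trans (sym (cong proj₁ e₁)) (trans (cong (shift (base K)) ε≡) (cong proj₁ e₂)))
    same-offset′ : ∀ m → offset K b₁ ≡ nothing → offset K′ b₁′ ≡ m → base K ≡ base K′
    same-offset′ (just x) _ ε₁′ = ⊥-elim (ne (trans e₁ (trans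
      (cong (embed K′) (offset-just-injective K′ ε₁′ (trans (sym ε′≡) ε₁′))) (sym e₂))))
    same-offset′ nothing ε₁ ε₁′ =
      trans (cong (shift (base K)) (sym ε₁)) (trans (cong proj₁ e₁) (cong (shift (base K′)) ε₁′))
    same-offset : ∀ m → offset K b₁ ≡ m → base K ≡ base K′
    same-offset (just x) ε₁ = ⊥-elim (ne (cong (embed K) (offset-just-injective K ε₁ (trans (sym ε≡) ε₁))))
    same-offset nothing  ε₁ = same-offset′ (offset K′ b₁′) ε₁ refl

  shared-point-anchored : ∀ o κ κ′ b b′ → κ ≢ κ′ → embed (o , κ) b ≡ embed (o , κ′) b′ →
    offset (o , κ) b ≡ nothing
  shared-point-anchored o κ κ′ b b′ κ≢κ′ e
    with offset (o , κ) b in ε | shift-injectiveʳ o (offset (o , κ) b) (offset (o , κ′) b′) (cong proj₁ e)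
  ... | nothing | _ = refl
  ... | just x  | ε≡ε′ = ⊥-elim (κ≢κ′ (proj₁ (coordinate-injective κ b κ′ b′
    (trans (sym (offset-just (o , κ) b ε)) (offset-just (o , κ′) b′ (sym ε≡ε′))))))

  _≟ᴾ_ : DecidableEquality Point
  _≟ᴾ_ = Vecₚ.≡-dec _≟_

  _≟ᴺ_ : DecidableEquality Node
  _≟ᴺ_ = Productₚ.≡-dec _≟ᴾ_ _≟_

  anchored-tuple-type : ∀ K {k} (u : Fin k → DB) → (∀ i → offset K (u i) ≡ nothing) →
    ∀ A → NoTrA σ A → tpOf σ MB u A ≡ tpOf σ MC (label K ∘ u) A
  anchored-tuple-type K u anchored A q = tpOf-pair-agree MB MC (Anchor.same (anchorOf K))
    (λ i → offset-nothing K (u i) (anchored i)) A (λ g → NoTrA⇒¬TrCross _ (NoTrA-rename g A q))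

  copy-coherent-constant : ∀ K K′ {k} (u u′ : Fin (suc k) → DB) → (∀ i → embed K (u i) ≡ embed K′ (u′ i)) →
    (∀ i → embed K (u i) ≡ embed K (u zero)) → ∀ A → tpOf σ MB u A ≡ tpOf σ MB u′ A
  copy-coherent-constant K K′ u u′ e constant A =
    tpOf-factor-agree MB MB {P = λ _ → ⊤} labels-agree (const zero) u≗ u′≗ A tt
    where
    labels-agree : ∀ B → ⊤ → tpOf σ MB (single σ (u zero)) B ≡ tpOf σ MB (single σ (u′ zero)) B
    labels-agree B _ = trans (label-type₁ K (u zero) B) (trans
      (cong (λ c → tpOf σ MC (single σ c) B) (cong proj₂ (e zero))) (sym (label-type₁ K′ (u′ zero) B)))
    u≗ : ∀ i → u i ≡ u zero
    u≗ i = embed-injective K _ _ (constant i)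
    u′≗ : ∀ i → u′ i ≡ u′ zero
    u′≗ i = embed-injective K′ _ _ (trans (sym (e i)) (trans (constant i) (e zero)))

  -- Copies sharing two distinct nodes have the same base point; copies with the same base point
  -- meet only in anchored points, whose type is read off MC.
  copy-coherent : ∀ K K′ {k} (u u′ : Fin k → DB) → (∀ i → embed K (u i) ≡ embed K′ (u′ i)) →
    ∀ A → NoTrA σ A → tpOf σ MB u A ≡ tpOf σ MB u′ A
  copy-coherent K K′ {zero} u u′ e A _ = tpOf-cong MB (λ ()) A
  copy-coherent K K′ {suc k} u u′ e A q with any? (λ i → ¬? (embed K (u i) ≟ᴺ embed K (u zero)))
  ... | no ¬distinct = copy-coherent-constant K K′ u u′ e constant A
    where
    constant : ∀ i → embed K (u i) ≡ embed K (u zero)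
    constant i with embed K (u i) ≟ᴺ embed K (u zero)
    ... | yes same = same
    ... | no  ne   = ⊥-elim (¬distinct (i , ne))
  copy-coherent (o , κ) (o′ , κ′) {suc k} u u′ e A q | yes (i , ne)
    with copies-share-base (o , κ) (o′ , κ′) (u i) (u zero) (u′ i) (u′ zero) (e i) (e zero) ne
       | Productₚ.≡-dec _≟_ _≟_ κ κ′
  ... | refl | yes refl = tpOf-cong MB (λ l → embed-injective (o , κ) _ _ (e l)) A
  ... | refl | no κ≢κ′  = begin
    tpOf σ MB u A                         ≡⟨ anchored-tuple-type (o , κ) u (λ l → shared-point-anchored o κ κ′ (u l) (u′ l) κ≢κ′ (e l)) A q ⟩
    tpOf σ MC (label (o , κ) ∘ u) A       ≡⟨ tpOf-cong MC (λ l → cong proj₂ (e l)) A ⟩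
    tpOf σ MC (label (o , κ′) ∘ u′) A     ≡⟨ sym (anchored-tuple-type (o , κ′) u′
                                               (λ l → shared-point-anchored o κ′ κ (u′ l) (u l) (κ≢κ′ ∘ sym) (sym (e l))) A q) ⟩
    tpOf σ MB u′ A                        ∎

  NonTr : Sym σ → Set
  NonTr (tr _) = ⊥
  NonTr (nt _) = ⊤
  NonTr aux    = ⊤

  NoTrA⇒NonTr : ∀ {k} s (xs : Vec (Fin k) (ar σ s)) → NoTrA σ (rel s xs) → NonTr s
  NoTrA⇒NonTr (nt _) _ _ = tt
  NoTrA⇒NonTr aux    _ _ = tt

  NonTr⇒NoTrA : ∀ {k} s (xs : Vec (Fin k) (ar σ s)) → NonTr s → NoTrA σ (rel s xs)
  NonTr⇒NoTrA (nt _) _ _ = tt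
  NonTr⇒NoTrA aux    _ _ = tt

  copy-coherent-R : ∀ s → NonTr s → ∀ K K′ (us us′ : Vec DB (ar σ s)) →
    map (embed K) us ≡ map (embed K′) us′ → RB s us ≡ RB s us′
  copy-coherent-R s nonTr K K′ us us′ e = begin
    RB s us                                     ≡⟨ cong (RB s) (sym (map-lookup-allFin us)) ⟩
    tpOf σ MB (lookup us) (rel s (allFin _))    ≡⟨ copy-coherent K K′ (lookup us) (lookup us′) same-nodes _ (NonTr⇒NoTrA s _ nonTr) ⟩
    tpOf σ MB (lookup us′) (rel s (allFin _))   ≡⟨ cong (RB s) (map-lookup-allFin us′) ⟩
    RB s us′                                    ∎
    where
    same-nodes : ∀ i → embed K (lookup us i) ≡ embed K′ (lookup us′ i)
    same-nodes i = trans (sym (lookup-map i (embed K) us)) (trans (cong (λ ys → lookup ys i) e) (lookup-map i (embed K′) us′))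

  Copied : (s : Sym σ) → Vec Node (ar σ s) → Set
  Copied s ys = Σ Copy λ K → Σ (Vec DB (ar σ s)) λ us → map (embed K) us ≡ ys × RB s us ≡ true

  abstract
    copied? : ∀ s ys → Dec (Copied s ys)
    copied? s ys = map′ (λ { (o , c , d , us , p) → (o , c , d) , us , p }) (λ { ((o , c , d) , us , p) → o , c , d , us , p })
      (any-Vec? Dim λ o → any? λ c → any? λ d → any-Vec? (ar σ s) λ us →
         Vecₚ.≡-dec _≟ᴺ_ (map (embed (o , c , d)) us) ys ×-dec (RB s us ≟ᵇ true))

  copied-image : ∀ s → NonTr s → ∀ K us → ⌊ copied? s (map (embed K) us) ⌋ ≡ RB s us
  copied-image s nonTr K us with RB s us in r
  ... | true  = ⌊⌋-true (copied? s (map (embed K) us)) (K , us , refl , r)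
  ... | false = ⌊⌋-false (copied? s (map (embed K) us)) λ { (K′ , us′ , e , r′) →
    case trans (sym r′) (trans (copy-coherent-R s nonTr K′ K us′ us e) r) of λ () }

  nodeR : (s : Sym σ) → Vec Node (ar σ s) → Bool
  nodeR (tr T) (y ∷ y′ ∷ []) = ⌊ proj₁ y ≟ᴾ proj₁ y′ ⌋ ∧ RC (tr T) (proj₂ y ∷ proj₂ y′ ∷ [])
  nodeR (nt P) ys = ⌊ copied? (nt P) ys ⌋
  nodeR aux    ys = ⌊ copied? aux ys ⌋

  nodeR-nonTr : ∀ s → NonTr s → ∀ ys → nodeR s ys ≡ ⌊ copied? s ys ⌋
  nodeR-nonTr (nt _) _ _ = refl
  nodeR-nonTr aux    _ _ = refl

  Nn : ℕ
  Nn = pred (3 ^ Dim * suc nC)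

  code : Node ↔ Fin (suc Nn)
  code = ↔-trans (Vec↔Fin^ Dim ×-↔ ↔-refl)
    (↔-trans (↔-sym *↔×) (Fin-cong (sym (suc-pred (3 ^ Dim * suc nC) {{m*n≢0 (3 ^ Dim) (suc nC) {{m^n≢0 3 Dim}}}}))))

  open OnCarrier σ _≟ᴺ_ code nodeR
  open Inverse code using () renaming (to to encode; from to decode; strictlyInverseʳ to decode-encode)

  N : Str σ Nn
  N = structure

  tpX-copy : ∀ K {k} (u : Fin k → DB) A → NoTrA σ A → tpX (embed K ∘ u) A ≡ tpOf σ MB u A
  tpX-copy K u (rel s xs) q = begin
    nodeR s (map (embed K ∘ u) xs)              ≡⟨ nodeR-nonTr s nonTr _ ⟩
    ⌊ copied? s (map (embed K ∘ u) xs) ⌋        ≡⟨ cong (⌊_⌋ ∘ copied? s) (map-∘ (embed K) u xs) ⟩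
    ⌊ copied? s (map (embed K) (map u xs)) ⌋    ≡⟨ copied-image s nonTr K (map u xs) ⟩
    RB s (map u xs)                             ∎
    where
    nonTr = NoTrA⇒NonTr s xs q
  tpX-copy K u (eq i j) _ = ⌊⌋-cong (mk⇔ (embed-injective K _ _) (cong (embed K))) _ _

  embed-b₁-at : ∀ o c d → embed (o , c , d) (Anchor.b₁ (anchor c d)) ≡ (o , c)
  embed-b₁-at o c d = trans (embed-b₁ (o , c , d)) (cong (o ,_) (anchor-c₁ c d))

  embed-b₂-at : ∀ o c d → Linked c d → embed (o , c , d) (Anchor.b₂ (anchor c d)) ≡ (o , d)
  embed-b₂-at o c d linked = trans (embed-b₂ (o , c , d)) (cong (o ,_) (anchor-c₂ c d linked))

  InCopy : ∀ {k} → (Fin k → Node) → Set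
  InCopy {k} v = Σ Copy λ K → Σ (Fin k → DB) λ u → ∀ i → v i ≡ embed K (u i)

  tpX-InCopy : ∀ {k} {v : Fin k → Node} ((K , u , _) : InCopy v) → ∀ A → NoTrA σ A → tpX v A ≡ tpOf σ MB u A
  tpX-InCopy (K , u , v≗) A q = trans (tpX-cong v≗ A) (tpX-copy K u A q)

  constant-InCopy : ∀ {k} (v : Fin k → Node) y → (∀ i → v i ≡ y) → InCopy v
  constant-InCopy v (o , c) v≗y = (o , c , c) , const (Anchor.b₁ (anchor c c)) , λ i → trans (v≗y i) (sym (embed-b₁-at o c c))

  guarded-InCopy : ∀ {k} (γ : Atom σ k) → NoTrA σ γ → Guards σ γ → (v : Fin k → Node) → tpX v γ ≡ true → InCopy v
  guarded-InCopy (rel s xs) q guards v holds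
    with ⌊⌋-witness (copied? s (map v xs)) (trans (sym (nodeR-nonTr s (NoTrA⇒NonTr s xs q) _)) holds)
  ... | K , us , e , _ = K , (λ i → lookup us (position i)) , λ i → begin
    v i                                    ≡⟨ cong v (VecAnyₚ.lookup-index (guards i)) ⟩
    v (lookup xs (position i))             ≡⟨ sym (lookup-map (position i) v xs) ⟩
    lookup (map v xs) (position i)         ≡⟨ cong (λ ys → lookup ys (position i)) (sym e) ⟩
    lookup (map (embed K) us) (position i) ≡⟨ lookup-map (position i) (embed K) us ⟩
    embed K (lookup us (position i))       ∎
    where
    position : _ → Fin (ar σ s)
    position i = VecAny.index (guards i)
  guarded-InCopy (eq i j) _ guards v holds = constant-InCopy v (v i) v≗vi
    where
    v≗vi : ∀ l → v l ≡ v i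
    v≗vi l with guards l
    ... | inj₁ refl = refl
    ... | inj₂ refl = sym (⌊⌋-witness (v i ≟ᴺ v l) holds)

  -- (o , c) and (o , d) are the anchored points of the copy (o , c , d).
  tpX-component : ∀ o c d → Linked c d → ∀ {k} (v : Fin k → Node) → (∀ i → v i ≡ (o , c) ⊎ v i ≡ (o , d)) →
    ∀ A → NoTrA σ A → tpX v A ≡ tpOf σ MC (proj₂ ∘ v) A
  tpX-component o c d linked v side A q = begin
    tpX v A                            ≡⟨ tpX-cong v≗ A ⟩
    tpX (embed K ∘ u) A                ≡⟨ tpX-copy K u A q ⟩
    tpOf σ MB u A                      ≡⟨ anchored-tuple-type K u anchored A q ⟩
    tpOf σ MC (label K ∘ u) A          ≡⟨ tpOf-cong MC (λ i → cong proj₂ (sym (v≗ i))) A ⟩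
    tpOf σ MC (proj₂ ∘ v) A            ∎
    where
    K = (o , c , d)
    u : _ → DB
    u i with side i
    ... | inj₁ _ = Anchor.b₁ (anchorOf K)
    ... | inj₂ _ = Anchor.b₂ (anchorOf K)
    v≗ : ∀ i → v i ≡ embed K (u i)
    v≗ i with side i
    ... | inj₁ refl = sym (embed-b₁-at o c d)
    ... | inj₂ refl = sym (embed-b₂-at o c d linked)
    anchored : ∀ i → offset K (u i) ≡ nothing
    anchored i with side i
    ... | inj₁ _ = offset-b₁ K
    ... | inj₂ _ = offset-b₂ K

  nodeR-tr : ∀ T y y′ → nodeR (tr T) (y ∷ y′ ∷ []) ≡ true →
    proj₁ y ≡ proj₁ y′ × RC (tr T) (proj₂ y ∷ proj₂ y′ ∷ []) ≡ true
  nodeR-tr T y y′ r with proj₁ y ≟ᴾ proj₁ y′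
  ... | yes same-base = same-base , r

  tpX-tr-in-component : ∀ {k} (v : Fin k → Node) o → (∀ i → proj₁ (v i) ≡ o) →
    ∀ T i j → tpX v (rel (tr T) (i ∷ j ∷ [])) ≡ tpOf σ MC (proj₂ ∘ v) (rel (tr T) (i ∷ j ∷ []))
  tpX-tr-in-component v o in-o T i j rewrite ⌊⌋-true (proj₁ (v i) ≟ᴾ proj₁ (v j)) (trans (in-o i) (sym (in-o j))) = refl

  N-transitive : Transitive σ N
  N-transitive T a b c r₁ r₂ with nodeR-tr T (decode a) (decode b) r₁ | nodeR-tr T (decode b) (decode c) r₂
  ... | base≡₁ , rc₁ | base≡₂ , rc₂ =
    trans (tpX-tr-in-component (decode ∘ pair σ a c) (proj₁ (decode a)) in-base T zero (suc zero))
          (MC-transitive T _ _ _ rc₁ rc₂)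
    where
    in-base : ∀ i → proj₁ (decode (pair σ a c i)) ≡ proj₁ (decode a)
    in-base zero       = refl
    in-base (suc zero) = sym (trans base≡₁ base≡₂)

  tpOf-N-InCopy : ∀ {k} {v : Fin k → Dom σ Nn} (copy : InCopy (decode ∘ v)) → ∀ A → NoTrA σ A →
    tpOf σ MB (proj₁ (proj₂ copy)) A ≡ tpOf σ N v A
  tpOf-N-InCopy {v = v} copy A q = sym (trans (tpOf-structure v A) (tpX-InCopy copy A q))

  N-SatA : ∀ c → SatA σ MB c → SatA σ N c
  N-SatA c sat v γ-holds with guarded-InCopy (ConjA.γ c) (ConjA.γ-ntr c) (ConjA.γ-grd c) (decode ∘ v)
    (trans (sym (tpOf-structure v (ConjA.γ c))) (Equivalence.to (holdsA⇔tpOf N (ConjA.γ c) v) γ-holds))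
  ... | copy@(K , u , v≗) with sat u (holdsA-transfer N MB (ConjA.γ c) (sym (tpOf-N-InCopy copy _ (ConjA.γ-ntr c))) γ-holds)
  ...   | w , ϑ-holds , ψ-holds = w′
      , holdsA-transfer MB N (ConjA.ϑ c) (agree _ (ConjA.ϑ-ntr c)) ϑ-holds
      , holdsQ-transfer MB N agree (ConjA.ψ c) (ConjA.ψ-ntr c) ψ-holds
    where
    w′ = encode ∘ embed K ∘ w
    extended : InCopy (decode ∘ (v VF.++ w′))
    extended = K , u VF.++ w , ++-cong decode (embed K) v≗ (λ i → decode-encode _)
    agree : ∀ A → NoTrA σ A → tpOf σ MB (u VF.++ w) A ≡ tpOf σ N (v VF.++ w′) A
    agree = tpOf-N-InCopy extended

  guard-Linked : ∀ {c d} (θ : Atom σ 2) → UsesTr σ θ → Guards σ θ → holdsA σ MC θ (pair σ c d) → Linked c d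
  guard-Linked {c} {d} (rel (tr T) xs) _ guards θ-holds with c ≟ d
  ... | yes c≡d = inj₁ c≡d
  ... | no  c≢d = inj₂ (c≢d , MC-aux-closed (tr T) xs (guards zero) (guards (suc zero)) c d θ-holds)

  tpOf-N-component : ∀ o c d → Linked c d → ∀ {k} (v : Fin k → Dom σ Nn) →
    (∀ i → decode (v i) ≡ (o , c) ⊎ decode (v i) ≡ (o , d)) → ∀ A → tpOf σ N v A ≡ tpOf σ MC (proj₂ ∘ decode ∘ v) A
  tpOf-N-component o c d linked v side A = trans (tpOf-structure v A) (agree A)
    where
    in-o : ∀ i → proj₁ (decode (v i)) ≡ o
    in-o i with side i
    ... | inj₁ e = cong proj₁ e
    ... | inj₂ e = cong proj₁ e
    agree : ∀ A → tpX (decode ∘ v) A ≡ tpOf σ MC (proj₂ ∘ decode ∘ v) A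
    agree (rel (tr T) (i ∷ j ∷ [])) = tpX-tr-in-component (decode ∘ v) o in-o T i j
    agree A@(rel (nt _) _) = tpX-component o c d linked (decode ∘ v) side A tt
    agree A@(rel aux _)    = tpX-component o c d linked (decode ∘ v) side A tt
    agree A@(eq _ _)       = tpX-component o c d linked (decode ∘ v) side A tt

  N-type₁ : ∀ x A → tpOf σ N (single σ x) A ≡ tpOf σ MC (single σ (proj₂ (decode x))) A
  N-type₁ x = tpOf-N-component _ _ _ (inj₁ refl) (single σ x) (λ _ → inj₁ refl)

  N-SatB : ∀ c → SatB σ MC c → SatB σ N c
  N-SatB c sat x γ-holds with sat (proj₂ (decode x)) (holdsA-transfer N MC (ConjB.γ c) (N-type₁ x (ConjB.γ c)) γ-holds)
  ... | d , θ-holds , ψ-holds =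
    y , holdsA-transfer MC N (ConjB.θ c) (sym (agree (ConjB.θ c))) θ-holds
      , holdsQ-transfer MC N (λ A _ → sym (agree A)) (ConjB.ψ c) (ConjB.ψ-ntr c) ψ-holds
    where
    o = proj₁ (decode x)
    y = encode (o , d)
    decode-pair : ∀ i → decode (pair σ x y i) ≡ (o , pair σ (proj₂ (decode x)) d i)
    decode-pair zero       = refl
    decode-pair (suc zero) = decode-encode (o , d)
    side : ∀ i → decode (pair σ x y i) ≡ (o , proj₂ (decode x)) ⊎ decode (pair σ x y i) ≡ (o , d)
    side zero       = inj₁ refl
    side (suc zero) = inj₂ (decode-encode (o , d))
    agree : ∀ A → tpOf σ N (pair σ x y) A ≡ tpOf σ MC (pair σ (proj₂ (decode x)) d) A
    agree A = trans (tpOf-N-component o _ d (guard-Linked (ConjB.θ c) (ConjB.θ-tr c) (ConjB.θ-grd c) θ-holds) _ side A)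
                    (tpOf-cong MC (cong proj₂ ∘ decode-pair) A)

  N-SatC-non-tr : ∀ {k} (γ : Atom σ k) → NoTrA σ γ → Guards σ γ → (ψ : QF σ k) → NoTr σ ψ →
    (∀ u → holdsA σ MB γ u → holdsQ σ MB ψ u) → ∀ v → holdsA σ N γ v → holdsQ σ N ψ v
  N-SatC-non-tr γ γ-ntr guards ψ ψ-ntr sat v γ-holds = holdsQ-transfer MB N agree ψ ψ-ntr
    (sat (proj₁ (proj₂ copy)) (holdsA-transfer N MB γ (sym (agree γ γ-ntr)) γ-holds))
    where
    copy : InCopy (decode ∘ v)
    copy = guarded-InCopy γ γ-ntr guards (decode ∘ v)
      (trans (sym (tpOf-structure v γ)) (Equivalence.to (holdsA⇔tpOf N γ v) γ-holds))
    agree : ∀ A → NoTrA σ A → tpOf σ MB (proj₁ (proj₂ copy)) A ≡ tpOf σ N v A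
    agree = tpOf-N-InCopy copy

  N-SatC-at : ∀ {k} (γ : Atom σ k) → Guards σ γ → (ψ : QF σ k) → NoTr σ ψ →
    (∀ u → holdsA σ MB γ u → holdsQ σ MB ψ u) → (UsesTr σ γ → ∀ w → holdsA σ MC γ w → holdsQ σ MC ψ w) →
    ∀ v → holdsA σ N γ v → holdsQ σ N ψ v
  N-SatC-at (rel (tr T) (i ∷ j ∷ [])) guards ψ ψ-ntr _ sat-MC v γ-holds
    with nodeR-tr T (decode (v i)) (decode (v j)) γ-holds
  ... | base≡ , rc = holdsQ-transfer MC N (λ A _ → sym (agree A)) ψ ψ-ntr
    (sat-MC tt (proj₂ ∘ decode ∘ v) (holdsA-transfer N MC (rel (tr T) (i ∷ j ∷ [])) (agree (rel (tr T) (i ∷ j ∷ []))) γ-holds))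
    where
    o = proj₁ (decode (v i))
    side : ∀ l → decode (v l) ≡ (o , proj₂ (decode (v i))) ⊎ decode (v l) ≡ (o , proj₂ (decode (v j)))
    side l with guards l
    ... | here refl         = inj₁ refl
    ... | there (here refl) = inj₂ (cong (_, proj₂ (decode (v j))) (sym base≡))
    agree : ∀ A → tpOf σ N v A ≡ tpOf σ MC (proj₂ ∘ decode ∘ v) A
    agree = tpOf-N-component o _ _ (guard-Linked (rel (tr T) (zero ∷ suc zero ∷ [])) tt
      (λ { zero → here refl ; (suc zero) → there (here refl) }) rc) v side
  N-SatC-at γ@(rel (nt _) _) guards ψ ψ-ntr sat-MB _ = N-SatC-non-tr γ tt guards ψ ψ-ntr sat-MB
  N-SatC-at γ@(rel aux _)    guards ψ ψ-ntr sat-MB _ = N-SatC-non-tr γ tt guards ψ ψ-ntr sat-MB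
  N-SatC-at γ@(eq _ _)       guards ψ ψ-ntr sat-MB _ = N-SatC-non-tr γ tt guards ψ ψ-ntr sat-MB

  N-SatC : ∀ c → SatC σ MB c → (UsesTr σ (ConjC.γ c) → SatC σ MC c) → SatC σ N c
  N-SatC c = N-SatC-at (ConjC.γ c) (ConjC.γ-grd c) (ConjC.ψ c) (ConjC.ψ-ntr c)

  aux-via-copy : ∀ K {m} (us : Vec DB m) (xs : Vec (Dom σ Nn) m) →
    (∀ i → decode (lookup xs i) ≡ embed K (lookup us i)) → (∀ i j → RB aux (lookup us i ∷ lookup us j ∷ []) ≡ true) →
    ∀ i j → Str.R N aux (lookup xs i ∷ lookup xs j ∷ []) ≡ true
  aux-via-copy K us xs xs≗ aux-us i j = trans
    (cong (λ ys → ⌊ copied? aux ys ⌋) (cong₂ (λ y y′ → y ∷ y′ ∷ []) (xs≗ i) (xs≗ j)))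
    (trans (copied-image aux tt K (lookup us i ∷ lookup us j ∷ [])) (aux-us i j))

  N-SatD-non-tr : ∀ s → NonTr s → ∀ xs → Str.R N s xs ≡ true →
    ∀ i j → Str.R N aux (lookup xs i ∷ lookup xs j ∷ []) ≡ true
  N-SatD-non-tr s nonTr xs r with ⌊⌋-witness (copied? s (map decode xs)) (trans (sym (nodeR-nonTr s nonTr _)) r)
  ... | K , us , e , rb = aux-via-copy K us xs xs≗ (MB-satD s us rb)
    where
    xs≗ : ∀ i → decode (lookup xs i) ≡ embed K (lookup us i)
    xs≗ i = trans (sym (lookup-map i decode xs))
      (trans (cong (λ ys → lookup ys i) (sym e)) (lookup-map i (embed K) us))

  N-SatD : SatD σ N
  N-SatD (nt P) = N-SatD-non-tr (nt P) tt
  N-SatD aux    = N-SatD-non-tr aux tt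
  N-SatD (tr T) (x ∷ y ∷ []) r with nodeR-tr T (decode x) (decode y) r
  ... | base≡ , rc with proj₂ (decode x) ≟ proj₂ (decode y)
  ...   | yes c≡d = aux-via-copy K (b₁ ∷ b₁ ∷ []) (x ∷ y ∷ []) xs≗ (MB-satD (tr T) (b₁ ∷ b₁ ∷ []) loop)
    where
    o = proj₁ (decode x)
    c = proj₂ (decode x)
    K = (o , c , c)
    b₁ = Anchor.b₁ (anchor c c)
    xs≗ : ∀ i → decode (lookup (x ∷ y ∷ []) i) ≡ embed K (lookup (b₁ ∷ b₁ ∷ []) i)
    xs≗ zero       = sym (embed-b₁-at o c c)
    xs≗ (suc zero) = trans (cong₂ _,_ (sym base≡) (sym c≡d)) (sym (embed-b₁-at o c c))
    loop : RB (tr T) (b₁ ∷ b₁ ∷ []) ≡ true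
    loop = begin
      RB (tr T) (b₁ ∷ b₁ ∷ [])                                  ≡⟨ Anchor.first-type₁ (anchor c c) (rel (tr T) (zero ∷ zero ∷ [])) ⟩
      RC (tr T) (Anchor.c₁ (anchor c c) ∷ Anchor.c₁ (anchor c c) ∷ []) ≡⟨ cong (λ c′ → RC (tr T) (c′ ∷ c′ ∷ [])) (anchor-c₁ c c) ⟩
      RC (tr T) (c ∷ c ∷ [])                                    ≡⟨ cong (λ d → RC (tr T) (c ∷ d ∷ [])) c≡d ⟩
      RC (tr T) (c ∷ proj₂ (decode y) ∷ [])                     ≡⟨ rc ⟩
      true                                                      ∎
  ...   | no c≢d = aux-via-copy K (b₁ ∷ b₂ ∷ []) (x ∷ y ∷ []) xs≗ (MB-satD aux (b₁ ∷ b₂ ∷ []) aux-b₁b₂)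
    where
    o = proj₁ (decode x)
    c = proj₂ (decode x)
    d = proj₂ (decode y)
    aux-cd : RC aux (c ∷ d ∷ []) ≡ true
    aux-cd = MC-aux-closed (tr T) (zero ∷ suc zero ∷ []) (here refl) (there (here refl)) c d rc
    linked : Linked c d
    linked = inj₂ (c≢d , aux-cd)
    K = (o , c , d)
    b₁ = Anchor.b₁ (anchor c d)
    b₂ = Anchor.b₂ (anchor c d)
    xs≗ : ∀ i → decode (lookup (x ∷ y ∷ []) i) ≡ embed K (lookup (b₁ ∷ b₂ ∷ []) i)
    xs≗ zero       = sym (embed-b₁-at o c d)
    xs≗ (suc zero) = trans (cong (_, d) (sym base≡)) (sym (embed-b₂-at o c d linked))
    aux-b₁b₂ : RB aux (b₁ ∷ b₂ ∷ []) ≡ true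
    aux-b₁b₂ = begin
      RB aux (b₁ ∷ b₂ ∷ [])                                      ≡⟨ Anchor.same (anchor c d) (rel aux (zero ∷ suc zero ∷ [])) (λ ()) ⟩
      RC aux (Anchor.c₁ (anchor c d) ∷ Anchor.c₂ (anchor c d) ∷ []) ≡⟨ cong₂ (λ c′ d′ → RC aux (c′ ∷ d′ ∷ [])) (anchor-c₁ c d) (anchor-c₂ c d linked) ⟩
      RC aux (c ∷ d ∷ [])                                        ≡⟨ aux-cd ⟩
      true                                                       ∎

  model : HasFinModel σ φ
  model = Nn , N , N-transitive
        , All.map (λ {c} → N-SatA c) MB-satA
        , All.map (λ {c} → N-SatB c) MC-satB
        , All.zipWith (λ {c} → uncurry (N-SatC c)) (MB-satC , MC-satC)
        , N-SatD

lemma4 : (σ : Signature) (φ : NF σ) → HasFinModel σ φ ⇔ Certificate σ φ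
lemma4 σ φ = mk⇔
  (λ (_ , M , M-transitive , M⊨φ) → FromFiniteModel.certificate σ φ M M-transitive M⊨φ)
  (λ (αs , βs , _ , _ , (_ , MB , _ , MB⊨) , (_ , MC , MC-transitive , MC⊨) , _) →
     ToFiniteModel.model σ φ αs βs MB MB⊨ MC MC-transitive MC⊨)
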